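{- Let $r$ be a complex number and let $m,n\ge0$ be integers. Then, as polynomials in $x$, $$d_m^{(r)}(x)d_n^{(r)}(x)=\sum_{k=0}^{\min\{m,n\}}\binom{m+n-2k}{m-k}\binom{2r+m+n-k}{k}(-1)^kd_{m+n-2k}^{(r)}(x).$$
   Context: For a complex number (or polynomial) $a$ and an integer $k\ge0$, $\binom{a}{k}=a(a-1)\cdots(a-k+1)/k!$, and $\binom{a}{k}=0$ for $k<0$. For a parameter $r$ and an integer $n\ge 0$, define the polynomial $d_n^{(r)}(x)=\sum_{k=0}^n\binom{x+r+k}{k}\binom{x-r}{n-k}$. -}

module Defs where

open import Level using (Level)
open import Data.Nat using (ℕ; zero; suc; _∸_; _!)
open import Data.Nat.Properties using (_!≢0)
open import Data.Integer using (+_)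
open import Data.Rational using (ℚ; _/_)
open import Algebra.Bundles using (CommutativeRing)

-- All definitions are relative to a commutative ring R together with a map
-- ι : ℚ → R (in the statement ι is required to be a ring homomorphism, i.e.
-- R is a ℚ-algebra; e.g. R = ℂ or R = ℂ[x]).
module _ {c ℓ : Level} (R : CommutativeRing c ℓ) (ι : ℚ → CommutativeRing.Carrier R) where
  open CommutativeRing R

  natR : ℕ → Carrier
  natR zero    = 0#
  natR (suc n) = 1# + natR n

  powR : Carrier → ℕ → Carrier
  powR a zero    = 1#
  powR a (suc k) = powR a k * a

  falling : Carrier → ℕ → Carrier
  falling a zero    = 1#
  falling a (suc k) = falling a k * (a - natR k)

  binom : Carrier → ℕ → Carrier
  binom a k = ι ((+ 1 / (k !)) {{k !≢0}}) * falling a k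

  sumTo : ℕ → (ℕ → Carrier) → Carrier
  sumTo zero    f = f 0
  sumTo (suc n) f = sumTo n f + f (suc n)

  d : ℕ → Carrier → Carrier → Carrier
  d n r x = sumTo n (λ k → binom (x + r + natR k) k * binom (x - r) (n ∸ k))

{-# OPTIONS --safe #-}
module Submission where

-- Splitting n+1 = k + (n+1-k) in each summand of d_{n+1} and absorbing the two parts into the two
-- binomial coefficients gives the recurrence (n+1) d_{n+1} = (2x+1) d_n + (n+2r) d_{n-1}.
-- For m < n, multiply the recurrence for d_{m+1} by d_n, expand d_m d_n and d_{m-1} d_n by
-- induction, and rewrite every (2x+1) d_N by the recurrence once more. Comparing the coefficients
-- of each d_N leaves one three-term identity between the coefficients
-- κ(a,b,k) = C(a+b,a) binom(2r+a+b+k, k) (-1)^k of d_{a+b} in d_{k+a} d_{k+b}; after multiplying by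
-- (1+a)(1+b)(1+k) all of its terms are polynomial multiples of C(a+b,a) binom(2r+a+b+k+1, k) (-1)^k,
-- so it is a polynomial identity. The case m > n follows by symmetry.

open import Level using (Level)
open import Data.Nat as ℕ using (ℕ; zero; suc; _!; _∸_; _≤_; _<_)
import Data.Nat.Properties as ℕₚ
open import Data.Nat.Properties using (_!≢0; m*n≢0; m+n∸m≡n; ≤-trans; <⇒≤; ≤-total; m≤n⇒m⊓n≡m; m≥n⇒m⊓n≡n; <-trans; m≤n⇒m≤1+n; ≤-refl; ≤-pred; n∸n≡0; +-∸-assoc; m+[n∸m]≡n)
open import Data.Integer as ℤ using (+_)
open import Data.Integer.Tactic.RingSolver using (solve-∀)
open import Data.Rational as ℚ using (ℚ; 0ℚ; 1ℚ; _/_; toℚᵘ)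
open import Data.Rational.Properties using (+-*-rawRing; toℚᵘ-injective; toℚᵘ-fromℚᵘ; toℚᵘ-homo-+; toℚᵘ-homo-*)
open import Data.Rational.Unnormalised as ℚᵘ using (mkℚᵘ; *≡*)
import Data.Rational.Unnormalised.Properties as ℚᵘ
open import Data.Sum using (inj₁; inj₂)
open import Data.Maybe using (Maybe; just; nothing)
open import Relation.Nullary using (yes; no)
open import Relation.Binary.PropositionalEquality as ≡ using (_≡_)
open import Algebra.Bundles using (CommutativeRing)
open import Algebra.Morphism.Structures using (IsRingHomomorphism)
open import Algebra.Solver.Ring.AlmostCommutativeRing using (fromCommutativeRing; _-Raw-AlmostCommutative⟶_)
open import Data.Nat.Combinatorics using (_C_)
import Defs as D

toℚᵘ-/ : ∀ a d → toℚᵘ (+ a / suc d) ℚᵘ.≃ mkℚᵘ (+ a) d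
toℚᵘ-/ a d = toℚᵘ-fromℚᵘ (mkℚᵘ (+ a) d)

1+[n/1]≡[1+n]/1 : ∀ n → 1ℚ ℚ.+ + n / 1 ≡ + suc n / 1
1+[n/1]≡[1+n]/1 n = toℚᵘ-injective (ℚᵘ.≃-trans (toℚᵘ-homo-+ 1ℚ (+ n / 1))
  (ℚᵘ.≃-trans (ℚᵘ.+-cong (toℚᵘ-/ 1 0) (toℚᵘ-/ n 0))
  (ℚᵘ.≃-trans (*≡* (cross (+ n))) (ℚᵘ.≃-sym (toℚᵘ-/ (suc n) 0)))))
  where
  cross : ∀ i → (+ 1 ℤ.* + 1 ℤ.+ i ℤ.* + 1) ℤ.* + 1 ≡ (+ 1 ℤ.+ i) ℤ.* (+ 1 ℤ.* + 1)
  cross = solve-∀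

1/[1+k]n*[1+k]≡1/n : ∀ k n .{{_ : ℕ.NonZero n}} → (+ 1 / (suc k ℕ.* n)) {{m*n≢0 (suc k) n}} ℚ.* (+ suc k / 1) ≡ + 1 / n
1/[1+k]n*[1+k]≡1/n k (suc j) = toℚᵘ-injective (ℚᵘ.≃-trans (toℚᵘ-homo-* (+ 1 / (suc k ℕ.* suc j)) (+ suc k / 1))
  (ℚᵘ.≃-trans (ℚᵘ.*-cong (toℚᵘ-/ 1 (j ℕ.+ k ℕ.* suc j)) (toℚᵘ-/ (suc k) 0))
  (ℚᵘ.≃-trans (*≡* (cross (+ k) (+ j))) (ℚᵘ.≃-sym (toℚᵘ-/ 1 j)))))
  where
  cross : ∀ i j → (+ 1 ℤ.* (+ 1 ℤ.+ i)) ℤ.* (+ 1 ℤ.+ j) ≡ + 1 ℤ.* ((+ 1 ℤ.+ i) ℤ.* (+ 1 ℤ.+ j) ℤ.* + 1)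
  cross = solve-∀

module _ where
  open import Data.Nat using (_+_; _*_)
  open import Data.Nat.Combinatorics using (nCk+nC[k+1]≡[n+1]C[k+1]; nC1≡n; nCk≡nC[n∸k])
  open import Data.Nat.Properties using (+-comm; +-suc; *-zeroʳ; *-identityˡ; *-identityʳ; m≤m+n; m+n∸n≡m)
  open import Data.Nat.Solver using (module +-*-Solver)
  open +-*-Solver
  open ≡.≡-Reasoning

  [1+k]*[1+n]C[1+k]≡[1+n]*nCk : ∀ n k → suc k * (suc n C suc k) ≡ suc n * (n C k)
  [1+k]*[1+n]C[1+k]≡[1+n]*nCk zero    zero    = ≡.refl
  [1+k]*[1+n]C[1+k]≡[1+n]*nCk zero    (suc k) = *-zeroʳ (suc (suc k))
  [1+k]*[1+n]C[1+k]≡[1+n]*nCk (suc n) zero    = ≡.trans (*-identityˡ _) (≡.trans (nC1≡n (suc (suc n))) (≡.sym (*-identityʳ _)))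
  [1+k]*[1+n]C[1+k]≡[1+n]*nCk (suc n) (suc k) = begin
    suc (suc k) * (suc (suc n) C suc (suc k))
      ≡⟨ ≡.cong (suc (suc k) *_) (≡.sym (nCk+nC[k+1]≡[n+1]C[k+1] (suc n) (suc k))) ⟩
    suc (suc k) * (suc n C suc k + suc n C suc (suc k))
      ≡⟨ solve 3 (λ k x y → (con 2 :+ k) :* (x :+ y) := (con 1 :+ k) :* x :+ x :+ (con 2 :+ k) :* y) ≡.refl k (suc n C suc k) (suc n C suc (suc k)) ⟩
    suc k * (suc n C suc k) + suc n C suc k + suc (suc k) * (suc n C suc (suc k))
      ≡⟨ ≡.cong₂ (λ u v → u + suc n C suc k + v) ([1+k]*[1+n]C[1+k]≡[1+n]*nCk n k) ([1+k]*[1+n]C[1+k]≡[1+n]*nCk n (suc k)) ⟩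
    suc n * (n C k) + suc n C suc k + suc n * (n C suc k)
      ≡⟨ solve 4 (λ n x y z → (con 1 :+ n) :* x :+ z :+ (con 1 :+ n) :* y := (con 1 :+ n) :* (x :+ y) :+ z) ≡.refl n (n C k) (n C suc k) (suc n C suc k) ⟩
    suc n * (n C k + n C suc k) + suc n C suc k
      ≡⟨ ≡.cong (λ u → suc n * u + suc n C suc k) (nCk+nC[k+1]≡[n+1]C[k+1] n k) ⟩
    suc n * (suc n C suc k) + suc n C suc k
      ≡⟨ solve 2 (λ n x → (con 1 :+ n) :* x :+ x := (con 2 :+ n) :* x) ≡.refl n (suc n C suc k) ⟩
    suc (suc n) * (suc n C suc k) ∎

  [a+b]Ca≡[a+b]Cb : ∀ a b → (a + b) C a ≡ (a + b) C b
  [a+b]Ca≡[a+b]Cb a b = ≡.trans (nCk≡nC[n∸k] (m≤m+n a b)) (≡.cong ((a + b) C_) (m+n∸m≡n a b))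

  [1+b]*[a+1+b]Ca≡[1+a+b]*[a+b]Ca : ∀ a b → suc b * ((a + suc b) C a) ≡ suc (a + b) * ((a + b) C a)
  [1+b]*[a+1+b]Ca≡[1+a+b]*[a+b]Ca a b = begin
    suc b * ((a + suc b) C a)       ≡⟨ ≡.cong (suc b *_) ([a+b]Ca≡[a+b]Cb a (suc b)) ⟩
    suc b * ((a + suc b) C suc b)   ≡⟨ ≡.cong (λ n → suc b * (n C suc b)) (+-suc a b) ⟩
    suc b * (suc (a + b) C suc b)   ≡⟨ ≡.cong (λ n → suc b * (suc n C suc b)) (+-comm a b) ⟩
    suc b * (suc (b + a) C suc b)   ≡⟨ [1+k]*[1+n]C[1+k]≡[1+n]*nCk (b + a) b ⟩
    suc (b + a) * ((b + a) C b)     ≡⟨ ≡.cong (λ n → suc n * (n C b)) (+-comm b a) ⟩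
    suc (a + b) * ((a + b) C b)     ≡⟨ ≡.cong (suc (a + b) *_) ([a+b]Ca≡[a+b]Cb a b) ⟨
    suc (a + b) * ((a + b) C a)     ∎

  [k+a]+[k+b]∸2k≡a+b : ∀ k a b → k + a + (k + b) ∸ 2 * k ≡ a + b
  [k+a]+[k+b]∸2k≡a+b k a b = ≡.trans (≡.cong (_∸ 2 * k)
    (solve 3 (λ k a b → k :+ a :+ (k :+ b) := a :+ b :+ con 2 :* k) ≡.refl k a b)) (m+n∸n≡m (a + b) (2 * k))

  [k+a]+[k+b]∸k≡a+b+k : ∀ k a b → k + a + (k + b) ∸ k ≡ a + b + k
  [k+a]+[k+b]∸k≡a+b+k k a b = ≡.trans (≡.cong (_∸ k)
    (solve 3 (λ k a b → k :+ a :+ (k :+ b) := a :+ b :+ k :+ k) ≡.refl k a b)) (m+n∸n≡m (a + b + k) k)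

module ProductFormula {c ℓ : Level} (R : CommutativeRing c ℓ) (ι : ℚ → CommutativeRing.Carrier R)
  (ι-hom : IsRingHomomorphism +-*-rawRing (CommutativeRing.rawRing R) ι) where

  open CommutativeRing R
  open IsRingHomomorphism ι-hom using (+-homo; *-homo; -‿homo; 0#-homo; 1#-homo)
  open import Relation.Binary.Reasoning.Setoid setoid

  -- ι, but sending 0ℚ and 1ℚ to 0# and 1# on the nose, so that the solver's constants 0 and 1
  -- are literally 0# and 1#.
  ι₀₁ : ℚ → Carrier
  ι₀₁ q with q ℚ.≟ 1ℚ | q ℚ.≟ 0ℚ
  ... | yes _ | _     = 1#
  ... | no _  | yes _ = 0#
  ... | no _  | no _  = ι q

  ι₀₁≈ι : ∀ q → ι₀₁ q ≈ ι q
  ι₀₁≈ι q with q ℚ.≟ 1ℚ | q ℚ.≟ 0ℚ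
  ... | yes ≡.refl | _          = sym 1#-homo
  ... | no _       | yes ≡.refl = sym 0#-homo
  ... | no _       | no _       = refl

  ι₀₁-morphism : +-*-rawRing -Raw-AlmostCommutative⟶ fromCommutativeRing R
  ι₀₁-morphism = record
    { ⟦_⟧    = ι₀₁
    ; +-homo = λ p q → trans (ι₀₁≈ι _) (trans (+-homo p q) (sym (+-cong (ι₀₁≈ι p) (ι₀₁≈ι q))))
    ; *-homo = λ p q → trans (ι₀₁≈ι _) (trans (*-homo p q) (sym (*-cong (ι₀₁≈ι p) (ι₀₁≈ι q))))
    ; -‿homo = λ p → trans (ι₀₁≈ι _) (trans (-‿homo p) (sym (-‿cong (ι₀₁≈ι p))))
    ; 0-homo = trans (ι₀₁≈ι _) 0#-homo
    ; 1-homo = refl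
    }

  ι₀₁-≟ : ∀ p q → Maybe (ι₀₁ p ≈ ι₀₁ q)
  ι₀₁-≟ p q with p ℚ.≟ q
  ... | yes ≡.refl = just refl
  ... | no _       = nothing

  open import Algebra.Solver.Ring +-*-rawRing (fromCommutativeRing R) ι₀₁-morphism ι₀₁-≟
    using (solve; _:=_; _:+_; _:*_; :-_; _:-_; con; Polynomial)

  one : ∀ {n} → Polynomial n
  one = con 1ℚ

  natR : ℕ → Carrier
  natR = D.natR R ι

  falling : Carrier → ℕ → Carrier
  falling = D.falling R ι

  binom : Carrier → ℕ → Carrier
  binom = D.binom R ι

  powR : Carrier → ℕ → Carrier
  powR = D.powR R ι

  natR-+ : ∀ m n → natR (m ℕ.+ n) ≈ natR m + natR n
  natR-+ zero    n = sym (+-identityˡ _)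
  natR-+ (suc m) n = trans (+-congˡ (natR-+ m n)) (sym (+-assoc _ _ _))

  natR-* : ∀ m n → natR (m ℕ.* n) ≈ natR m * natR n
  natR-* zero    n = sym (zeroˡ _)
  natR-* (suc m) n = begin
    natR (n ℕ.+ m ℕ.* n)        ≈⟨ trans (natR-+ n (m ℕ.* n)) (+-congˡ (natR-* m n)) ⟩
    natR n + natR m * natR n    ≈⟨ solve 2 (λ a b → b :+ a :* b := (one :+ a) :* b) refl (natR m) (natR n) ⟩
    (1# + natR m) * natR n      ∎

  natR≈ι : ∀ n → natR n ≈ ι (+ n / 1)
  natR≈ι zero    = sym 0#-homo
  natR≈ι (suc n) = begin
    1# + natR n                 ≈⟨ +-cong (sym 1#-homo) (natR≈ι n) ⟩
    ι 1ℚ + ι (+ n / 1)          ≈⟨ sym (+-homo _ _) ⟩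
    ι (1ℚ ℚ.+ + n / 1)          ≡⟨ ≡.cong ι (1+[n/1]≡[1+n]/1 n) ⟩
    ι (+ suc n / 1)             ∎

  natR-split : ∀ {k n} → k ≤ n → natR n ≈ natR k + natR (n ∸ k)
  natR-split {k} {n} k≤n = trans (reflexive (≡.cong natR (≡.sym (m+[n∸m]≡n k≤n)))) (natR-+ k (n ∸ k))

  natR-*-≡ : ∀ m n p q → m ℕ.* n ≡ p ℕ.* q → natR m * natR n ≈ natR p * natR q
  natR-*-≡ m n p q eq = trans (sym (natR-* m n)) (trans (reflexive (≡.cong natR eq)) (natR-* p q))

  natR-absorb : ∀ n k → natR (suc k) * natR (suc n C suc k) ≈ natR (suc n) * natR (n C k)
  natR-absorb n k = natR-*-≡ (suc k) (suc n C suc k) (suc n) (n C k) ([1+k]*[1+n]C[1+k]≡[1+n]*nCk n k)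

  natR-absorbʳ : ∀ a b → natR (suc b) * natR ((a ℕ.+ suc b) C a) ≈ natR (suc (a ℕ.+ b)) * natR ((a ℕ.+ b) C a)
  natR-absorbʳ a b = natR-*-≡ (suc b) ((a ℕ.+ suc b) C a) (suc (a ℕ.+ b)) ((a ℕ.+ b) C a) ([1+b]*[a+1+b]Ca≡[1+a+b]*[a+b]Ca a b)

  1/! : ℕ → Carrier
  1/! k = ι ((+ 1 / k !) {{k !≢0}})

  1/!-suc : ∀ k → 1/! (suc k) * natR (suc k) ≈ 1/! k
  1/!-suc k = begin
    1/! (suc k) * natR (suc k)  ≈⟨ *-congˡ (natR≈ι (suc k)) ⟩
    1/! (suc k) * ι (+ suc k / 1) ≈⟨ sym (*-homo _ _) ⟩
    ι ((+ 1 / suc k !) {{suc k !≢0}} ℚ.* (+ suc k / 1)) ≡⟨ ≡.cong ι (1/[1+k]n*[1+k]≡1/n k (k !) {{k !≢0}}) ⟩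
    1/! k                       ∎

  1/!*natR! : ∀ n → 1/! n * natR (n !) ≈ 1#
  1/!*natR! zero    = trans (*-cong 1#-homo (+-identityʳ 1#)) (*-identityˡ 1#)
  1/!*natR! (suc n) = begin
    1/! (suc n) * natR (suc n ℕ.* n !)          ≈⟨ *-congˡ (natR-* (suc n) (n !)) ⟩
    1/! (suc n) * (natR (suc n) * natR (n !))   ≈⟨ sym (*-assoc _ _ _) ⟩
    1/! (suc n) * natR (suc n) * natR (n !)     ≈⟨ *-congʳ (1/!-suc n) ⟩
    1/! n * natR (n !)                          ≈⟨ 1/!*natR! n ⟩
    1#                                          ∎

  natR-suc-cancelˡ : ∀ n {a b} → natR (suc n) * a ≈ natR (suc n) * b → a ≈ b
  natR-suc-cancelˡ n {a} {b} eq = begin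
    a                     ≈⟨ sym (trans (*-congʳ inverse) (*-identityˡ a)) ⟩
    u * natR (suc n) * a  ≈⟨ trans (*-assoc _ _ _) (*-congˡ eq) ⟩
    u * (natR (suc n) * b) ≈⟨ trans (sym (*-assoc _ _ _)) (trans (*-congʳ inverse) (*-identityˡ b)) ⟩
    b                     ∎
    where
    u : Carrier
    u = 1/! (suc n) * natR (n !)
    inverse : u * natR (suc n) ≈ 1#
    inverse = begin
      1/! (suc n) * natR (n !) * natR (suc n)   ≈⟨ solve 3 (λ i f s → i :* f :* s := i :* s :* f) refl (1/! (suc n)) (natR (n !)) (natR (suc n)) ⟩
      1/! (suc n) * natR (suc n) * natR (n !)   ≈⟨ *-congʳ (1/!-suc n) ⟩
      1/! n * natR (n !)                        ≈⟨ 1/!*natR! n ⟩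
      1#                                        ∎

  falling-cong : ∀ k {y z} → y ≈ z → falling y k ≈ falling z k
  falling-cong zero    y≈z = refl
  falling-cong (suc k) y≈z = *-cong (falling-cong k y≈z) (+-congʳ y≈z)

  binom-cong : ∀ k {y z} → y ≈ z → binom y k ≈ binom z k
  binom-cong k y≈z = *-congˡ (falling-cong k y≈z)

  binom-zero : ∀ y → binom y 0 ≈ 1#
  binom-zero y = trans (*-identityʳ _) 1#-homo

  binom-suc : ∀ y k → natR (suc k) * binom y (suc k) ≈ (y - natR k) * binom y k
  binom-suc y k = begin
    natR (suc k) * (1/! (suc k) * (falling y k * (y - natR k)))
      ≈⟨ solve 4 (λ n i f w → n :* (i :* (f :* w)) := w :* (i :* n :* f)) refl (natR (suc k)) (1/! (suc k)) (falling y k) (y - natR k) ⟩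
    (y - natR k) * (1/! (suc k) * natR (suc k) * falling y k)
      ≈⟨ *-congˡ (*-congʳ (1/!-suc k)) ⟩
    (y - natR k) * (1/! k * falling y k) ∎

  falling-1+ : ∀ y k → falling (1# + y) (suc k) ≈ (1# + y) * falling y k
  falling-1+ y zero    = solve 1 (λ y → one :* ((one :+ y) :- con 0ℚ) := (one :+ y) :* one) refl y
  falling-1+ y (suc k) = begin
    falling (1# + y) (suc k) * (1# + y - (1# + natR k))  ≈⟨ *-congʳ (falling-1+ y k) ⟩
    (1# + y) * falling y k * (1# + y - (1# + natR k))   ≈⟨ solve 3 (λ y f n → (one :+ y) :* f :* (one :+ y :- (one :+ n)) := (one :+ y) :* (f :* (y :- n))) refl y (falling y k) (natR k) ⟩
    (1# + y) * (falling y k * (y - natR k))             ∎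

  binom-1+-suc : ∀ y k → natR (suc k) * binom (1# + y) (suc k) ≈ (1# + y) * binom y k
  binom-1+-suc y k = begin
    natR (suc k) * (1/! (suc k) * falling (1# + y) (suc k))  ≈⟨ *-congˡ (*-congˡ (falling-1+ y k)) ⟩
    natR (suc k) * (1/! (suc k) * ((1# + y) * falling y k))
      ≈⟨ solve 4 (λ n i w f → n :* (i :* (w :* f)) := w :* (i :* n :* f)) refl (natR (suc k)) (1/! (suc k)) (1# + y) (falling y k) ⟩
    (1# + y) * (1/! (suc k) * natR (suc k) * falling y k)    ≈⟨ *-congˡ (*-congʳ (1/!-suc k)) ⟩
    (1# + y) * (1/! k * falling y k)                        ∎

  binom-1+ : ∀ y k → (1# + y - natR k) * binom (1# + y) k ≈ (1# + y) * binom y k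
  binom-1+ y k = trans (sym (binom-suc (1# + y) k)) (binom-1+-suc y k)

  sumBelow : ℕ → (ℕ → Carrier) → Carrier
  sumBelow zero    f = 0#
  sumBelow (suc n) f = sumBelow n f + f n

  syntax sumBelow n (λ k → e) = Σ[ k < n ] e

  sumTo≈sumBelow : ∀ n f → D.sumTo R ι n f ≈ sumBelow (suc n) f
  sumTo≈sumBelow zero    f = sym (+-identityˡ _)
  sumTo≈sumBelow (suc n) f = +-congʳ (sumTo≈sumBelow n f)

  sumBelow-cong : ∀ n {f g} → (∀ k → k < n → f k ≈ g k) → sumBelow n f ≈ sumBelow n g
  sumBelow-cong zero    f≈g = refl
  sumBelow-cong (suc n) f≈g = +-cong (sumBelow-cong n (λ k k<n → f≈g k (m≤n⇒m≤1+n k<n))) (f≈g n ≤-refl)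

  sumBelow-+ : ∀ n f g → Σ[ k < n ] (f k + g k) ≈ sumBelow n f + sumBelow n g
  sumBelow-+ zero    f g = sym (+-identityˡ _)
  sumBelow-+ (suc n) f g = trans (+-congʳ (sumBelow-+ n f g))
    (solve 4 (λ a b c d → a :+ b :+ (c :+ d) := a :+ c :+ (b :+ d)) refl (sumBelow n f) (sumBelow n g) (f n) (g n))

  sumBelow-- : ∀ n f g → Σ[ k < n ] (f k - g k) ≈ sumBelow n f - sumBelow n g
  sumBelow-- zero    f g = solve 0 (con 0ℚ := con 0ℚ :- con 0ℚ) refl
  sumBelow-- (suc n) f g = trans (+-congʳ (sumBelow-- n f g))
    (solve 4 (λ a b c d → a :- b :+ (c :- d) := a :+ c :- (b :+ d)) refl (sumBelow n f) (sumBelow n g) (f n) (g n))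

  *-distribˡ-sumBelow : ∀ n a f → a * sumBelow n f ≈ Σ[ k < n ] (a * f k)
  *-distribˡ-sumBelow zero    a f = zeroʳ a
  *-distribˡ-sumBelow (suc n) a f = trans (distribˡ a _ _) (+-congʳ (*-distribˡ-sumBelow n a f))

  sumBelow-suc : ∀ n f → sumBelow (suc n) f ≈ f 0 + Σ[ k < n ] f (suc k)
  sumBelow-suc zero    f = trans (+-identityˡ _) (sym (+-identityʳ _))
  sumBelow-suc (suc n) f = trans (+-congʳ (sumBelow-suc n f)) (+-assoc _ _ _)

  sumBelow-regroup : ∀ m {T U V W : ℕ → Carrier} → T 0 ≈ U 0 →
    (∀ k → k < m → T (suc k) ≈ U (suc k) - V k + W k) → T (suc m) ≈ - V m →
    sumBelow (suc (suc m)) T ≈ Σ[ k < suc m ] (U k - V k) + sumBelow m W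
  sumBelow-regroup m {T} {U} {V} {W} first middle last = begin
    sumBelow (suc (suc m)) T
      ≈⟨ sumBelow-suc (suc m) T ⟩
    T 0 + (Σ[ k < m ] T (suc k) + T (suc m))
      ≈⟨ +-cong first (+-cong (sumBelow-cong m middle) last) ⟩
    U 0 + (Σ[ k < m ] (U (suc k) - V k + W k) + - V m)
      ≈⟨ +-congˡ (+-congʳ (trans (sumBelow-+ m _ W) (+-congʳ (sumBelow-- m _ V)))) ⟩
    U 0 + (Σ[ k < m ] U (suc k) - sumBelow m V + sumBelow m W + - V m)
      ≈⟨ solve 5 (λ u₀ u v w vₘ → u₀ :+ (u :- v :+ w :+ :- vₘ) := u₀ :+ u :- (v :+ vₘ) :+ w) refl
           (U 0) (Σ[ k < m ] U (suc k)) (sumBelow m V) (sumBelow m W) (V m) ⟩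
    U 0 + Σ[ k < m ] U (suc k) - sumBelow (suc m) V + sumBelow m W
      ≈⟨ +-congʳ (trans (+-congʳ (sym (sumBelow-suc m U))) (sym (sumBelow-- (suc m) U V))) ⟩
    Σ[ k < suc m ] (U k - V k) + sumBelow m W ∎

  -- The linearization coefficients

  module _ (r : Carrier) where

    -- κ a b k is the coefficient of d_{a+b} in d_{k+a} d_{k+b}.
    κ : ℕ → ℕ → ℕ → Carrier
    κ a b k = natR ((a ℕ.+ b) C a) * binom (r + r + natR (a ℕ.+ b ℕ.+ k)) k * powR (- 1#) k

    module κ-scaled (a b k : ℕ) where
      A B K s Cab p G : Carrier
      A = natR a
      B = natR b
      K = natR k
      s = r + r + (A + (1# + B) + K)
      Cab = natR ((a ℕ.+ b) C a)
      p = powR (- 1#) k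
      G = Cab * binom s k * p

      natR-1+a+b : natR (suc (a ℕ.+ b)) ≈ 1# + (A + B)
      natR-1+a+b = +-congˡ (natR-+ a b)

      s-shape : r + r + natR (a ℕ.+ b ℕ.+ suc k) ≈ s
      s-shape = +-congˡ (trans (natR-+ (a ℕ.+ b) (suc k)) (trans (+-congʳ (natR-+ a b))
        (solve 3 (λ A B K → A :+ B :+ (one :+ K) := A :+ (one :+ B) :+ K) refl A B K)))

      1+s-shape : r + r + natR (suc (a ℕ.+ b ℕ.+ suc k)) ≈ 1# + s
      1+s-shape = trans (solve 2 (λ r n → r :+ r :+ (one :+ n) := one :+ (r :+ r :+ n)) refl r (natR (a ℕ.+ b ℕ.+ suc k))) (+-congˡ s-shape)

      s-shape′ : r + r + natR (a ℕ.+ suc b ℕ.+ k) ≈ s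
      s-shape′ = trans (reflexive (≡.cong (λ n → r + r + natR n) a+[1+b]+k≡a+b+[1+k])) s-shape
        where
        a+[1+b]+k≡a+b+[1+k] : a ℕ.+ suc b ℕ.+ k ≡ a ℕ.+ b ℕ.+ suc k
        a+[1+b]+k≡a+b+[1+k] = ≡.trans (≡.cong (ℕ._+ k) (ℕₚ.+-suc a b)) (≡.sym (ℕₚ.+-suc (a ℕ.+ b) k))

      1+s-shape′ : r + r + natR (suc (a ℕ.+ suc b ℕ.+ k)) ≈ 1# + s
      1+s-shape′ = trans (solve 2 (λ r n → r :+ r :+ (one :+ n) := one :+ (r :+ r :+ n)) refl r (natR (a ℕ.+ suc b ℕ.+ k))) (+-congˡ s-shape′)

      κ₁-scaled : natR (suc a) * natR (suc k) * κ (suc a) b (suc k) ≈ - ((1# + (A + B)) * (1# + s) * G)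
      κ₁-scaled = begin
        natR (suc a) * natR (suc k) * (X * Y * (p * - 1#))
          ≈⟨ solve 5 (λ a k X Y p → a :* k :* (X :* Y :* (p :* :- one)) := :- ((a :* X) :* (k :* Y) :* p)) refl
               (natR (suc a)) (natR (suc k)) X Y p ⟩
        - ((natR (suc a) * X) * (natR (suc k) * Y) * p)
          ≈⟨ -‿cong (*-congʳ (*-cong (natR-absorb (a ℕ.+ b) a) (trans (*-congˡ (binom-cong (suc k) 1+s-shape)) (binom-1+-suc s k)))) ⟩
        - ((natR (suc (a ℕ.+ b)) * Cab) * ((1# + s) * binom s k) * p)
          ≈⟨ -‿cong (trans (*-congʳ (*-congʳ (*-congʳ natR-1+a+b)))
               (solve 5 (λ N c s β p → N :* c :* ((one :+ s) :* β) :* p := N :* (one :+ s) :* (c :* β :* p)) refl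
                 (1# + (A + B)) Cab s (binom s k) p)) ⟩
        - ((1# + (A + B)) * (1# + s) * G) ∎
        where
        X Y : Carrier
        X = natR ((suc a ℕ.+ b) C suc a)
        Y = binom (r + r + natR (suc a ℕ.+ b ℕ.+ suc k)) (suc k)

      κ₂-scaled : natR (suc k) * κ a b (suc k) ≈ - ((s - K) * G)
      κ₂-scaled = begin
        natR (suc k) * (Cab * Y * (p * - 1#))
          ≈⟨ solve 4 (λ k c Y p → k :* (c :* Y :* (p :* :- one)) := :- (c :* (k :* Y) :* p)) refl (natR (suc k)) Cab Y p ⟩
        - (Cab * (natR (suc k) * Y) * p)
          ≈⟨ -‿cong (*-congʳ (*-congˡ (trans (*-congˡ (binom-cong (suc k) s-shape)) (binom-suc s k)))) ⟩
        - (Cab * ((s - K) * binom s k) * p)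
          ≈⟨ -‿cong (solve 4 (λ c w β p → c :* (w :* β) :* p := w :* (c :* β :* p)) refl Cab (s - K) (binom s k) p) ⟩
        - ((s - K) * G) ∎
        where
        Y : Carrier
        Y = binom (r + r + natR (a ℕ.+ b ℕ.+ suc k)) (suc k)

      κ₃-scaled : natR (suc a) * natR (suc b) * (κ (suc a) (suc b) k * (1# + s - K))
                  ≈ (1# + (A + (1# + B))) * (1# + (A + B)) * (1# + s) * G
      κ₃-scaled = begin
        natR (suc a) * natR (suc b) * (X * Y * p * w)
          ≈⟨ solve 6 (λ a b X Y p w → a :* b :* (X :* Y :* p :* w) := b :* (a :* X) :* (w :* Y) :* p) refl
               (natR (suc a)) (natR (suc b)) X Y p w ⟩
        natR (suc b) * (natR (suc a) * X) * (w * Y) * p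
          ≈⟨ *-congʳ (*-cong (*-congˡ (natR-absorb (a ℕ.+ suc b) a)) (*-congˡ (binom-cong k 1+s-shape′))) ⟩
        natR (suc b) * (natR (suc (a ℕ.+ suc b)) * Z) * (w * binom (1# + s) k) * p
          ≈⟨ *-congʳ (*-congʳ (solve 3 (λ b M Z → b :* (M :* Z) := M :* (b :* Z)) refl (natR (suc b)) (natR (suc (a ℕ.+ suc b))) Z)) ⟩
        natR (suc (a ℕ.+ suc b)) * (natR (suc b) * Z) * (w * binom (1# + s) k) * p
          ≈⟨ *-congʳ (*-cong (*-cong (+-congˡ (natR-+ a (suc b))) (trans (natR-absorbʳ a b) (*-congʳ natR-1+a+b))) (binom-1+ s k)) ⟩
        (1# + (A + (1# + B))) * ((1# + (A + B)) * Cab) * ((1# + s) * binom s k) * p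
          ≈⟨ solve 6 (λ M N c s β p → M :* (N :* c) :* ((one :+ s) :* β) :* p := M :* N :* (one :+ s) :* (c :* β :* p)) refl
               (1# + (A + (1# + B))) (1# + (A + B)) Cab s (binom s k) p ⟩
        (1# + (A + (1# + B))) * (1# + (A + B)) * (1# + s) * G ∎
        where
        X Y Z w : Carrier
        X = natR ((suc a ℕ.+ suc b) C suc a)
        Y = binom (r + r + natR (suc a ℕ.+ suc b ℕ.+ k)) k
        Z = natR ((a ℕ.+ suc b) C a)
        w = 1# + s - K

      κ₄-scaled : natR (suc b) * κ a (suc b) k ≈ (1# + (A + B)) * G
      κ₄-scaled = begin
        natR (suc b) * (Z * Y * p)           ≈⟨ solve 4 (λ b Z Y p → b :* (Z :* Y :* p) := b :* Z :* Y :* p) refl (natR (suc b)) Z Y p ⟩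
        natR (suc b) * Z * Y * p             ≈⟨ *-congʳ (*-cong (trans (natR-absorbʳ a b) (*-congʳ natR-1+a+b)) (binom-cong k s-shape′)) ⟩
        (1# + (A + B)) * Cab * binom s k * p ≈⟨ solve 4 (λ N c β p → N :* c :* β :* p := N :* (c :* β :* p)) refl (1# + (A + B)) Cab (binom s k) p ⟩
        (1# + (A + B)) * G                   ∎
        where
        Z Y : Carrier
        Z = natR ((a ℕ.+ suc b) C a)
        Y = binom (r + r + natR (a ℕ.+ suc b ℕ.+ k)) k

      scale : Carrier → Carrier
      scale c = natR (suc k) * (natR (suc b) * (natR (suc a) * c))

      P : Carrier
      P = - ((1# + B) * (1# + (1# + (K + A))) * (1# + (A + B)) * (1# + s) * G)

      lhs-scaled : scale (natR (suc (suc k ℕ.+ a)) * κ (suc a) b (suc k)) ≈ P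
      lhs-scaled = begin
        natR (suc k) * (natR (suc b) * (natR (suc a) * (natR (suc (suc k ℕ.+ a)) * κ (suc a) b (suc k))))
          ≈⟨ solve 5 (λ k b a w c → k :* (b :* (a :* (w :* c))) := b :* w :* (a :* k :* c)) refl
               (natR (suc k)) (natR (suc b)) (natR (suc a)) (natR (suc (suc k ℕ.+ a))) (κ (suc a) b (suc k)) ⟩
        natR (suc b) * natR (suc (suc k ℕ.+ a)) * (natR (suc a) * natR (suc k) * κ (suc a) b (suc k))
          ≈⟨ *-cong (*-congˡ (+-congˡ (+-congˡ (natR-+ k a)))) κ₁-scaled ⟩
        (1# + B) * (1# + (1# + (K + A))) * - ((1# + (A + B)) * (1# + s) * G)
          ≈⟨ solve 5 (λ B W N s G → (one :+ B) :* W :* :- (N :* (one :+ s) :* G) := :- ((one :+ B) :* W :* N :* (one :+ s) :* G)) refl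
               B (1# + (1# + (K + A))) (1# + (A + B)) s G ⟩
        P ∎

      rhs-scaled : scale (κ a b (suc k) * natR (suc (a ℕ.+ b)) - κ (suc a) (suc b) k * (natR (suc a ℕ.+ suc b) + (r + r))
                          + (natR (suc k ℕ.+ a) + (r + r)) * κ a (suc b) k) ≈ P
      rhs-scaled = begin
        scale (c₂ * natR (suc (a ℕ.+ b)) - c₃ * (natR (suc a ℕ.+ suc b) + (r + r)) + (natR (suc k ℕ.+ a) + (r + r)) * c₄)
          ≈⟨ *-congˡ (*-congˡ (*-congˡ (+-cong (+-cong (*-congˡ natR-1+a+b) (-‿cong (*-congˡ w₃-shape))) (*-congʳ w₄-shape)))) ⟩
        scale (c₂ * (1# + (A + B)) - c₃ * (1# + s - K) + (1# + (K + A) + (r + r)) * c₄)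
          ≈⟨ solve 10 (λ A B K r s c₂ c₃ c₄ N W →
               (one :+ K) :* ((one :+ B) :* ((one :+ A) :* (c₂ :* N :- c₃ :* (one :+ s :- K) :+ W :* c₄)))
               := (one :+ A) :* (one :+ B) :* N :* ((one :+ K) :* c₂)
                  :- (one :+ K) :* ((one :+ A) :* (one :+ B) :* (c₃ :* (one :+ s :- K)))
                  :+ (one :+ A) :* (one :+ K) :* W :* ((one :+ B) :* c₄)) refl
               A B K r s c₂ c₃ c₄ (1# + (A + B)) (1# + (K + A) + (r + r)) ⟩
        (1# + A) * (1# + B) * (1# + (A + B)) * (natR (suc k) * c₂)
          - (1# + K) * (natR (suc a) * natR (suc b) * (c₃ * (1# + s - K)))
          + (1# + A) * (1# + K) * (1# + (K + A) + (r + r)) * (natR (suc b) * c₄)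
          ≈⟨ +-cong (+-cong (*-congˡ κ₂-scaled) (-‿cong (*-congˡ κ₃-scaled))) (*-congˡ κ₄-scaled) ⟩
        (1# + A) * (1# + B) * (1# + (A + B)) * - ((s - K) * G)
          - (1# + K) * ((1# + (A + (1# + B))) * (1# + (A + B)) * (1# + s) * G)
          + (1# + A) * (1# + K) * (1# + (K + A) + (r + r)) * ((1# + (A + B)) * G)
          ≈⟨ solve 5 (λ A B K r G → let s = r :+ r :+ (A :+ (one :+ B) :+ K) in
               (one :+ A) :* (one :+ B) :* (one :+ (A :+ B)) :* :- ((s :- K) :* G)
               :- (one :+ K) :* ((one :+ (A :+ (one :+ B))) :* (one :+ (A :+ B)) :* (one :+ s) :* G)
               :+ (one :+ A) :* (one :+ K) :* (one :+ (K :+ A) :+ (r :+ r)) :* ((one :+ (A :+ B)) :* G)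
               := :- ((one :+ B) :* (one :+ (one :+ (K :+ A))) :* (one :+ (A :+ B)) :* (one :+ s) :* G)) refl A B K r G ⟩
        P ∎
        where
        c₂ c₃ c₄ : Carrier
        c₂ = κ a b (suc k)
        c₃ = κ (suc a) (suc b) k
        c₄ = κ a (suc b) k
        w₃-shape : natR (suc a ℕ.+ suc b) + (r + r) ≈ 1# + s - K
        w₃-shape = trans (+-congʳ (+-congˡ (natR-+ a (suc b))))
          (solve 4 (λ r A B K → one :+ (A :+ (one :+ B)) :+ (r :+ r) := one :+ (r :+ r :+ (A :+ (one :+ B) :+ K)) :- K) refl r A B K)
        w₄-shape : natR (suc k ℕ.+ a) + (r + r) ≈ 1# + (K + A) + (r + r)
        w₄-shape = +-congʳ (+-congˡ (natR-+ k a))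

    κ-recurrence : ∀ a b k → natR (suc (suc k ℕ.+ a)) * κ (suc a) b (suc k)
      ≈ κ a b (suc k) * natR (suc (a ℕ.+ b)) - κ (suc a) (suc b) k * (natR (suc a ℕ.+ suc b) + (r + r))
        + (natR (suc k ℕ.+ a) + (r + r)) * κ a (suc b) k
    κ-recurrence a b k = natR-suc-cancelˡ a (natR-suc-cancelˡ b (natR-suc-cancelˡ k (trans lhs-scaled (sym rhs-scaled))))
      where open κ-scaled a b k

    κ-first : ∀ a b → natR (suc a) * κ (suc a) b 0 ≈ κ a b 0 * natR (suc (a ℕ.+ b))
    κ-first a b = begin
      natR (suc a) * (X * binom (r + r + natR (suc a ℕ.+ b ℕ.+ 0)) 0 * 1#)
        ≈⟨ *-congˡ (*-congʳ (*-congˡ (trans (binom-zero (r + r + natR (suc a ℕ.+ b ℕ.+ 0))) (sym (binom-zero β-arg))))) ⟩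
      natR (suc a) * (X * binom β-arg 0 * 1#)
        ≈⟨ solve 3 (λ a X β → a :* (X :* β :* one) := a :* X :* (β :* one)) refl (natR (suc a)) X (binom β-arg 0) ⟩
      natR (suc a) * X * (binom β-arg 0 * 1#)
        ≈⟨ *-congʳ (natR-absorb (a ℕ.+ b) a) ⟩
      natR (suc (a ℕ.+ b)) * Cab * (binom β-arg 0 * 1#)
        ≈⟨ solve 3 (λ N c β → N :* c :* (β :* one) := c :* β :* one :* N) refl (natR (suc (a ℕ.+ b))) Cab (binom β-arg 0) ⟩
      Cab * binom β-arg 0 * 1# * natR (suc (a ℕ.+ b)) ∎
      where
      X Cab β-arg : Carrier
      X = natR ((suc a ℕ.+ b) C suc a)
      Cab = natR ((a ℕ.+ b) C a)
      β-arg = r + r + natR (a ℕ.+ b ℕ.+ 0)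

    κ-last : ∀ b k → natR (suc k) * κ 0 b (suc k) ≈ - (κ 0 (suc b) k * (natR (suc b) + (r + r)))
    κ-last b k = begin
      natR (suc k) * (natR 1 * Y * (p * - 1#))
        ≈⟨ solve 4 (λ k c Y p → k :* (c :* Y :* (p :* :- one)) := :- (c :* (k :* Y) :* p)) refl (natR (suc k)) (natR 1) Y p ⟩
      - (natR 1 * (natR (suc k) * Y) * p)
        ≈⟨ -‿cong (*-congʳ (*-congˡ (binom-suc y k))) ⟩
      - (natR 1 * ((y - natR k) * binom y k) * p)
        ≈⟨ -‿cong (*-congʳ (*-congˡ (*-cong weight (reflexive (≡.cong (λ n → binom (r + r + natR n) k) (ℕₚ.+-suc b k)))))) ⟩
      - (natR 1 * ((natR (suc b) + (r + r)) * binom (r + r + natR (suc b ℕ.+ k)) k) * p)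
        ≈⟨ -‿cong (solve 4 (λ c w β p → c :* (w :* β) :* p := c :* β :* p :* w) refl (natR 1) (natR (suc b) + (r + r)) (binom (r + r + natR (suc b ℕ.+ k)) k) p) ⟩
      - (natR 1 * binom (r + r + natR (suc b ℕ.+ k)) k * p * (natR (suc b) + (r + r))) ∎
      where
      y Y p : Carrier
      y = r + r + natR (b ℕ.+ suc k)
      Y = binom y (suc k)
      p = powR (- 1#) k
      weight : y - natR k ≈ natR (suc b) + (r + r)
      weight = trans (+-congʳ (+-congˡ (natR-+ b (suc k))))
        (solve 3 (λ r B K → r :+ r :+ (B :+ (one :+ K)) :- K := one :+ B :+ (r :+ r)) refl r (natR b) (natR k))

    coeff : ℕ → ℕ → ℕ → Carrier
    coeff m n k = natR ((m ℕ.+ n ∸ 2 ℕ.* k) C (m ∸ k)) * binom (r + r + natR (m ℕ.+ n ∸ k)) k * powR (- 1#) k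

    κ-sym : ∀ a b k → κ a b k ≡ κ b a k
    κ-sym a b k = ≡.cong₂ (λ c n → natR c * binom (r + r + natR (n ℕ.+ k)) k * powR (- 1#) k)
      (≡.trans ([a+b]Ca≡[a+b]Cb a b) (≡.cong (_C b) (ℕₚ.+-comm a b))) (ℕₚ.+-comm a b)

    coeff-κ : ∀ {m n} k a b → m ≡ k ℕ.+ a → n ≡ k ℕ.+ b → coeff m n k ≡ κ a b k
    coeff-κ k a b ≡.refl ≡.refl rewrite [k+a]+[k+b]∸2k≡a+b k a b | m+n∸m≡n k a | [k+a]+[k+b]∸k≡a+b+k k a b = ≡.refl

    module _ (x : Carrier) where

      -- The three-term recurrence

      δ : ℕ → Carrier
      δ n = D.d R ι n r x

      δ-pred : ℕ → Carrier
      δ-pred zero    = 0#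
      δ-pred (suc n) = δ n

      summand : ℕ → ℕ → Carrier
      summand n k = binom (x + r + natR k) k * binom (x - r) (n ∸ k)

      [1+k]*summand : ∀ n k → natR (suc k) * summand (suc n) (suc k) ≈ (x + r + natR (suc k)) * summand n k
      [1+k]*summand n k = begin
        natR (suc k) * (binom (x + r + natR (suc k)) (suc k) * b)  ≈⟨ sym (*-assoc _ _ _) ⟩
        natR (suc k) * binom (x + r + natR (suc k)) (suc k) * b    ≈⟨ *-congʳ (*-congˡ (binom-cong (suc k) shift)) ⟩
        natR (suc k) * binom (1# + y) (suc k) * b                  ≈⟨ *-congʳ (binom-1+-suc y k) ⟩
        (1# + y) * binom y k * b                                   ≈⟨ trans (*-assoc _ _ _) (*-congʳ (sym shift)) ⟩
        (x + r + natR (suc k)) * (binom y k * b)                   ∎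
        where
        y b : Carrier
        y = x + r + natR k
        b = binom (x - r) (n ∸ k)
        shift : x + r + natR (suc k) ≈ 1# + y
        shift = solve 3 (λ x r n → x :+ r :+ (one :+ n) := one :+ (x :+ r :+ n)) refl x r (natR k)

      [1+n∸k]*summand : ∀ n k → k ≤ n → natR (suc n ∸ k) * summand (suc n) k ≈ (x - r - natR (n ∸ k)) * summand n k
      [1+n∸k]*summand n k k≤n rewrite +-∸-assoc 1 k≤n = begin
        natR (suc j) * (a * binom (x - r) (suc j))    ≈⟨ solve 3 (λ n a b → n :* (a :* b) := a :* (n :* b)) refl (natR (suc j)) a (binom (x - r) (suc j)) ⟩
        a * (natR (suc j) * binom (x - r) (suc j))    ≈⟨ *-congˡ (binom-suc (x - r) j) ⟩
        a * ((x - r - natR j) * binom (x - r) j)      ≈⟨ solve 3 (λ a w b → a :* (w :* b) := w :* (a :* b)) refl a (x - r - natR j) (binom (x - r) j) ⟩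
        (x - r - natR j) * (a * binom (x - r) j)      ∎
        where
        j : ℕ
        j = n ∸ k
        a : Carrier
        a = binom (x + r + natR k) k

      δ-sum : ∀ n → δ n ≈ Σ[ k < suc n ] summand n k
      δ-sum n = sumTo≈sumBelow n (summand n)

      Σk*summand : ∀ n → Σ[ k < suc (suc n) ] (natR k * summand (suc n) k) ≈ Σ[ k < suc n ] ((x + r + natR (suc k)) * summand n k)
      Σk*summand n = begin
        Σ[ k < suc (suc n) ] (natR k * summand (suc n) k)
          ≈⟨ sumBelow-suc (suc n) _ ⟩
        0# * summand (suc n) 0 + Σ[ k < suc n ] (natR (suc k) * summand (suc n) (suc k))
          ≈⟨ +-cong (zeroˡ _) (sumBelow-cong (suc n) (λ k _ → [1+k]*summand n k)) ⟩
        0# + Σ[ k < suc n ] ((x + r + natR (suc k)) * summand n k)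
          ≈⟨ +-identityˡ _ ⟩
        Σ[ k < suc n ] ((x + r + natR (suc k)) * summand n k) ∎

      Σ[1+n∸k]*summand : ∀ n → Σ[ k < suc (suc n) ] (natR (suc n ∸ k) * summand (suc n) k) ≈ Σ[ k < suc n ] ((x - r - natR (n ∸ k)) * summand n k)
      Σ[1+n∸k]*summand n = begin
        Σ[ k < suc n ] (natR (suc n ∸ k) * summand (suc n) k) + natR (n ∸ n) * summand (suc n) (suc n)
          ≈⟨ +-cong (sumBelow-cong (suc n) (λ k k<1+n → [1+n∸k]*summand n k (≤-pred k<1+n))) top-vanishes ⟩
        Σ[ k < suc n ] ((x - r - natR (n ∸ k)) * summand n k) + 0#
          ≈⟨ +-identityʳ _ ⟩
        Σ[ k < suc n ] ((x - r - natR (n ∸ k)) * summand n k) ∎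
        where
        top-vanishes : natR (n ∸ n) * summand (suc n) (suc n) ≈ 0#
        top-vanishes = trans (*-congʳ (reflexive (≡.cong natR (n∸n≡0 n)))) (zeroˡ _)

      [1+n]*δ[1+n]-split : ∀ n → natR (suc n) * δ (suc n) ≈
        Σ[ k < suc n ] ((x + r + natR (suc k)) * summand n k) + Σ[ k < suc n ] ((x - r - natR (n ∸ k)) * summand n k)
      [1+n]*δ[1+n]-split n = begin
        natR (suc n) * δ (suc n)
          ≈⟨ trans (*-congˡ (δ-sum (suc n))) (*-distribˡ-sumBelow (suc (suc n)) _ _) ⟩
        Σ[ k < suc (suc n) ] (natR (suc n) * summand (suc n) k)
          ≈⟨ sumBelow-cong (suc (suc n)) (λ k k<2+n → trans (*-congʳ (natR-split (≤-pred k<2+n))) (distribʳ _ _ _)) ⟩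
        Σ[ k < suc (suc n) ] (natR k * summand (suc n) k + natR (suc n ∸ k) * summand (suc n) k)
          ≈⟨ trans (sumBelow-+ (suc (suc n)) _ _) (+-cong (Σk*summand n) (Σ[1+n∸k]*summand n)) ⟩
        Σ[ k < suc n ] ((x + r + natR (suc k)) * summand n k) + Σ[ k < suc n ] ((x - r - natR (n ∸ k)) * summand n k) ∎

      index-difference-sum : ∀ n → Σ[ k < suc n ] ((natR k - natR (n ∸ k)) * summand n k) ≈ (natR n + (r + r)) * δ-pred n
      index-difference-sum zero = solve 2 (λ r t → con 0ℚ :+ (con 0ℚ :- con 0ℚ) :* t := (con 0ℚ :+ (r :+ r)) :* con 0ℚ) refl r (summand 0 0)
      index-difference-sum (suc n) = begin
        Σ[ k < suc (suc n) ] ((natR k - natR (suc n ∸ k)) * summand (suc n) k)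
          ≈⟨ sumBelow-cong (suc (suc n)) (λ k _ → distrib-minus (natR k) (natR (suc n ∸ k)) (summand (suc n) k)) ⟩
        Σ[ k < suc (suc n) ] (natR k * summand (suc n) k - natR (suc n ∸ k) * summand (suc n) k)
          ≈⟨ trans (sumBelow-- (suc (suc n)) _ _) (+-cong (Σk*summand n) (-‿cong (Σ[1+n∸k]*summand n))) ⟩
        Σ[ k < suc n ] ((x + r + natR (suc k)) * summand n k) - Σ[ k < suc n ] ((x - r - natR (n ∸ k)) * summand n k)
          ≈⟨ sym (sumBelow-- (suc n) _ _) ⟩
        Σ[ k < suc n ] ((x + r + natR (suc k)) * summand n k - (x - r - natR (n ∸ k)) * summand n k)
          ≈⟨ sumBelow-cong (suc n) (λ k k<1+n → weights (≤-pred k<1+n)) ⟩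
        Σ[ k < suc n ] ((natR (suc n) + (r + r)) * summand n k)
          ≈⟨ trans (sym (*-distribˡ-sumBelow (suc n) _ _)) (*-congˡ (sym (δ-sum n))) ⟩
        (natR (suc n) + (r + r)) * δ n ∎
        where
        distrib-minus : ∀ a b t → (a - b) * t ≈ a * t - b * t
        distrib-minus = solve 3 (λ a b t → (a :- b) :* t := a :* t :- b :* t) refl
        weights : ∀ {k} → k ≤ n → (x + r + natR (suc k)) * summand n k - (x - r - natR (n ∸ k)) * summand n k ≈ (natR (suc n) + (r + r)) * summand n k
        weights {k} k≤n = begin
          (x + r + (1# + natR k)) * summand n k - (x - r - natR (n ∸ k)) * summand n k
            ≈⟨ solve 5 (λ x r a b t → (x :+ r :+ (one :+ a)) :* t :- (x :- r :- b) :* t := (one :+ (a :+ b) :+ (r :+ r)) :* t) refl x r (natR k) (natR (n ∸ k)) (summand n k) ⟩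
          (1# + (natR k + natR (n ∸ k)) + (r + r)) * summand n k
            ≈⟨ *-congʳ (+-congʳ (+-congˡ (sym (natR-split k≤n)))) ⟩
          (natR (suc n) + (r + r)) * summand n k ∎

      δ-recurrence : ∀ n → natR (suc n) * δ (suc n) ≈ (x + x + 1#) * δ n + (natR n + (r + r)) * δ-pred n
      δ-recurrence n = begin
        natR (suc n) * δ (suc n)
          ≈⟨ trans ([1+n]*δ[1+n]-split n) (sym (sumBelow-+ (suc n) _ _)) ⟩
        Σ[ k < suc n ] ((x + r + natR (suc k)) * summand n k + (x - r - natR (n ∸ k)) * summand n k)
          ≈⟨ sumBelow-cong (suc n) (λ k _ → regroup (natR k) (natR (n ∸ k)) (summand n k)) ⟩
        Σ[ k < suc n ] ((x + x + 1#) * summand n k + (natR k - natR (n ∸ k)) * summand n k)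
          ≈⟨ sumBelow-+ (suc n) _ _ ⟩
        Σ[ k < suc n ] ((x + x + 1#) * summand n k) + Σ[ k < suc n ] ((natR k - natR (n ∸ k)) * summand n k)
          ≈⟨ +-cong (trans (sym (*-distribˡ-sumBelow (suc n) _ _)) (*-congˡ (sym (δ-sum n)))) (index-difference-sum n) ⟩
        (x + x + 1#) * δ n + (natR n + (r + r)) * δ-pred n ∎
        where
        regroup : ∀ a b t → (x + r + (1# + a)) * t + (x - r - b) * t ≈ (x + x + 1#) * t + (a - b) * t
        regroup a b t = solve 5 (λ x r a b t → (x :+ r :+ (one :+ a)) :* t :+ (x :- r :- b) :* t := (x :+ x :+ one) :* t :+ (a :- b) :* t) refl x r a b t

      [2x+1]*δ : ∀ n → (x + x + 1#) * δ n ≈ natR (suc n) * δ (suc n) - (natR n + (r + r)) * δ-pred n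
      [2x+1]*δ n = trans (solve 2 (λ u v → u := u :+ v :- v) refl ((x + x + 1#) * δ n) ((natR n + (r + r)) * δ-pred n))
        (+-congʳ (sym (δ-recurrence n)))

      term : ℕ → ℕ → ℕ → Carrier
      term m n k = coeff m n k * δ (m ℕ.+ n ∸ 2 ℕ.* k)

      -- By the recurrence, (2x+1) * term m n k = raised m n k - lowered m n k. The k-th terms of
      -- (m+1) d_{m+1} d_n and of (m+2r) d_{m-1} d_n are scaled-next m n k and from-pred m n k.
      raised lowered from-pred scaled-next : ℕ → ℕ → ℕ → Carrier
      raised m n k = coeff m n k * (natR (suc (m ℕ.+ n ∸ 2 ℕ.* k)) * δ (suc (m ℕ.+ n ∸ 2 ℕ.* k)))
      lowered m n k = coeff m n k * ((natR (m ℕ.+ n ∸ 2 ℕ.* k) + (r + r)) * δ-pred (m ℕ.+ n ∸ 2 ℕ.* k))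
      from-pred m n k = (natR m + (r + r)) * term (m ∸ 1) n k
      scaled-next m n k = natR (suc m) * term (suc m) n k

      module _ {m n} k a b (m≡k+a : m ≡ k ℕ.+ a) (n≡k+b : n ≡ k ℕ.+ b) where
        private
          degree : m ℕ.+ n ∸ 2 ℕ.* k ≡ a ℕ.+ b
          degree = ≡.trans (≡.cong₂ (λ m n → m ℕ.+ n ∸ 2 ℕ.* k) m≡k+a n≡k+b) ([k+a]+[k+b]∸2k≡a+b k a b)

        term-κ : term m n k ≡ κ a b k * δ (a ℕ.+ b)
        term-κ = ≡.cong₂ (λ c N → c * δ N) (coeff-κ k a b m≡k+a n≡k+b) degree

        raised-κ : raised m n k ≡ κ a b k * (natR (suc (a ℕ.+ b)) * δ (suc (a ℕ.+ b)))
        raised-κ = ≡.cong₂ (λ c N → c * (natR (suc N) * δ (suc N))) (coeff-κ k a b m≡k+a n≡k+b) degree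

        lowered-κ : lowered m n k ≡ κ a b k * ((natR (a ℕ.+ b) + (r + r)) * δ-pred (a ℕ.+ b))
        lowered-κ = ≡.cong₂ (λ c N → c * ((natR N + (r + r)) * δ-pred N)) (coeff-κ k a b m≡k+a n≡k+b) degree

      [2x+1]*term : ∀ m n k → (x + x + 1#) * term m n k ≈ raised m n k - lowered m n k
      [2x+1]*term m n k = begin
        (x + x + 1#) * (γ * δ N)                                   ≈⟨ solve 3 (λ t c d → t :* (c :* d) := c :* (t :* d)) refl (x + x + 1#) γ (δ N) ⟩
        γ * ((x + x + 1#) * δ N)                                   ≈⟨ *-congˡ ([2x+1]*δ N) ⟩
        γ * (natR (suc N) * δ (suc N) - (natR N + (r + r)) * δ-pred N)
          ≈⟨ solve 3 (λ c u v → c :* (u :- v) := c :* u :- c :* v) refl γ (natR (suc N) * δ (suc N)) ((natR N + (r + r)) * δ-pred N) ⟩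
        γ * (natR (suc N) * δ (suc N)) - γ * ((natR N + (r + r)) * δ-pred N) ∎
        where
        γ : Carrier
        γ = coeff m n k
        N : ℕ
        N = m ℕ.+ n ∸ 2 ℕ.* k

      next-first : ∀ m n → scaled-next m n 0 ≈ raised m n 0
      next-first m n = begin
        natR (suc m) * term (suc m) n 0                       ≡⟨ ≡.cong (natR (suc m) *_) (term-κ 0 (suc m) n ≡.refl ≡.refl) ⟩
        natR (suc m) * (κ (suc m) n 0 * δ (suc (m ℕ.+ n)))    ≈⟨ sym (*-assoc _ _ _) ⟩
        natR (suc m) * κ (suc m) n 0 * δ (suc (m ℕ.+ n))      ≈⟨ *-congʳ (κ-first m n) ⟩
        κ m n 0 * natR (suc (m ℕ.+ n)) * δ (suc (m ℕ.+ n))    ≈⟨ *-assoc _ _ _ ⟩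
        κ m n 0 * (natR (suc (m ℕ.+ n)) * δ (suc (m ℕ.+ n)))  ≡⟨ raised-κ 0 m n ≡.refl ≡.refl ⟨
        raised m n 0                                          ∎

      next-last : ∀ {m n} b → n ≡ suc m ℕ.+ b → scaled-next m n (suc m) ≈ - lowered m n m
      next-last {m} b ≡.refl = begin
        natR (suc m) * term (suc m) (suc m ℕ.+ b) (suc m)         ≡⟨ ≡.cong (natR (suc m) *_) (term-κ (suc m) 0 b (≡.sym (ℕₚ.+-identityʳ (suc m))) ≡.refl) ⟩
        natR (suc m) * (κ 0 b (suc m) * δ b)                      ≈⟨ sym (*-assoc _ _ _) ⟩
        natR (suc m) * κ 0 b (suc m) * δ b                        ≈⟨ *-congʳ (κ-last b m) ⟩
        - (κ 0 (suc b) m * (natR (suc b) + (r + r))) * δ b         ≈⟨ solve 3 (λ c w d → :- (c :* w) :* d := :- (c :* (w :* d))) refl (κ 0 (suc b) m) (natR (suc b) + (r + r)) (δ b) ⟩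
        - (κ 0 (suc b) m * ((natR (suc b) + (r + r)) * δ b))       ≡⟨ ≡.cong -_ (lowered-κ m 0 (suc b) (≡.sym (ℕₚ.+-identityʳ m)) (≡.sym (ℕₚ.+-suc m b))) ⟨
        - lowered m (suc m ℕ.+ b) m                               ∎

      next-middle : ∀ {m n} k a b → m ≡ suc k ℕ.+ a → n ≡ suc k ℕ.+ b →
        scaled-next m n (suc k) ≈ raised m n (suc k) - lowered m n k + from-pred m n k
      next-middle k a b ≡.refl ≡.refl = begin
        natR (suc m′) * term (suc m′) n′ (suc k)
          ≡⟨ ≡.cong (natR (suc m′) *_) (term-κ (suc k) (suc a) b (≡.sym (ℕₚ.+-suc (suc k) a)) ≡.refl) ⟩
        natR (suc m′) * (c₁ * D)
          ≈⟨ trans (sym (*-assoc _ _ _)) (*-congʳ (κ-recurrence a b k)) ⟩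
        (c₂ * natR (suc (a ℕ.+ b)) - c₃ * w₃ + w₄ * c₄) * D
          ≈⟨ solve 7 (λ c₂ N c₃ w₃ w₄ c₄ D → (c₂ :* N :- c₃ :* w₃ :+ w₄ :* c₄) :* D := c₂ :* (N :* D) :- c₃ :* (w₃ :* D) :+ w₄ :* (c₄ :* D)) refl
               c₂ (natR (suc (a ℕ.+ b))) c₃ w₃ w₄ c₄ D ⟩
        c₂ * (natR (suc (a ℕ.+ b)) * D) - c₃ * (w₃ * D) + w₄ * (c₄ * D)
          ≡⟨ ≡.cong (λ E → c₂ * (natR (suc (a ℕ.+ b)) * D) - c₃ * (w₃ * E) + w₄ * (c₄ * E)) (≡.cong δ (ℕₚ.+-suc a b)) ⟨
        c₂ * (natR (suc (a ℕ.+ b)) * D) - c₃ * (w₃ * δ (a ℕ.+ suc b)) + w₄ * (c₄ * δ (a ℕ.+ suc b))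
          ≡⟨ ≡.cong₂ _+_ (≡.cong₂ _-_ (raised-κ (suc k) a b ≡.refl ≡.refl) (lowered-κ k (suc a) (suc b) k+[1+a] k+[1+b]))
               (≡.cong (w₄ *_) (term-κ k a (suc b) ≡.refl k+[1+b])) ⟨
        raised m′ n′ (suc k) - lowered m′ n′ k + from-pred m′ n′ k ∎
        where
        m′ n′ : ℕ
        m′ = suc k ℕ.+ a
        n′ = suc k ℕ.+ b
        c₁ c₂ c₃ c₄ w₃ w₄ D : Carrier
        c₁ = κ (suc a) b (suc k)
        c₂ = κ a b (suc k)
        c₃ = κ (suc a) (suc b) k
        c₄ = κ a (suc b) k
        w₃ = natR (suc a ℕ.+ suc b) + (r + r)
        w₄ = natR m′ + (r + r)
        D = δ (suc (a ℕ.+ b))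
        k+[1+a] : m′ ≡ k ℕ.+ suc a
        k+[1+a] = ≡.sym (ℕₚ.+-suc k a)
        k+[1+b] : n′ ≡ k ℕ.+ suc b
        k+[1+b] = ≡.sym (ℕₚ.+-suc k b)

      δ-zero : δ 0 ≈ 1#
      δ-zero = trans (*-cong (binom-zero (x + r + natR 0)) (binom-zero (x - r))) (*-identityˡ 1#)

      product-zero : ∀ n → δ 0 * δ n ≈ sumBelow 1 (term 0 n)
      product-zero n = begin
        δ 0 * δ n                                      ≈⟨ *-congʳ δ-zero ⟩
        1# * δ n                                       ≈⟨ solve 1 (λ d → one :* d := con 0ℚ :+ (one :+ con 0ℚ) :* one :* one :* d) refl (δ n) ⟩
        0# + natR 1 * 1# * 1# * δ n                    ≈⟨ +-congˡ (*-congʳ (*-congʳ (*-congˡ (sym (binom-zero (r + r + natR n)))))) ⟩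
        0# + natR 1 * binom (r + r + natR n) 0 * 1# * δ n ∎

      product-step : ∀ m n → m < n → δ m * δ n ≈ sumBelow (suc m) (term m n) → δ-pred m * δ n ≈ sumBelow m (term (m ∸ 1) n) →
        δ (suc m) * δ n ≈ sumBelow (suc (suc m)) (term (suc m) n)
      product-step m n m<n ih ih-pred = natR-suc-cancelˡ m (begin
        natR (suc m) * (δ (suc m) * δ n)
          ≈⟨ trans (sym (*-assoc _ _ _)) (*-congʳ (δ-recurrence m)) ⟩
        ((x + x + 1#) * δ m + (natR m + (r + r)) * δ-pred m) * δ n
          ≈⟨ solve 5 (λ t a w b c → (t :* a :+ w :* b) :* c := t :* (a :* c) :+ w :* (b :* c)) refl (x + x + 1#) (δ m) (natR m + (r + r)) (δ-pred m) (δ n) ⟩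
        (x + x + 1#) * (δ m * δ n) + (natR m + (r + r)) * (δ-pred m * δ n)
          ≈⟨ +-cong (*-congˡ ih) (*-congˡ ih-pred) ⟩
        (x + x + 1#) * sumBelow (suc m) (term m n) + (natR m + (r + r)) * sumBelow m (term (m ∸ 1) n)
          ≈⟨ +-cong (trans (*-distribˡ-sumBelow (suc m) _ _) (sumBelow-cong (suc m) (λ k _ → [2x+1]*term m n k))) (*-distribˡ-sumBelow m _ _) ⟩
        Σ[ k < suc m ] (raised m n k - lowered m n k) + sumBelow m (from-pred m n)
          ≈⟨ sumBelow-regroup m (next-first m n) middle (next-last (n ∸ suc m) (≡.sym (m+[n∸m]≡n m<n))) ⟨
        sumBelow (suc (suc m)) (scaled-next m n)
          ≈⟨ *-distribˡ-sumBelow (suc (suc m)) (natR (suc m)) (term (suc m) n) ⟨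
        natR (suc m) * sumBelow (suc (suc m)) (term (suc m) n) ∎)
        where
        middle : ∀ k → k < m → scaled-next m n (suc k) ≈ raised m n (suc k) - lowered m n k + from-pred m n k
        middle k k<m = next-middle k (m ∸ suc k) (n ∸ suc k) (≡.sym (m+[n∸m]≡n k<m)) (≡.sym (m+[n∸m]≡n (<-trans k<m m<n)))

      product-≤ : ∀ m n → m ≤ n → δ m * δ n ≈ sumBelow (suc m) (term m n)
      product-≤ zero          n _   = product-zero n
      product-≤ (suc zero)    n 1≤n = product-step 0 n 1≤n (product-zero n) (zeroˡ _)
      product-≤ (suc (suc m)) n m<n = product-step (suc m) n m<n (product-≤ (suc m) n (<⇒≤ m<n))
        (product-≤ m n (<⇒≤ (<⇒≤ m<n)))

      term-sym : ∀ m n k → k ≤ n → n ≤ m → term n m k ≡ term m n k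
      term-sym m n k k≤n n≤m = ≡.trans (term-κ k (n ∸ k) (m ∸ k) n≡k+[n∸k] m≡k+[m∸k])
        (≡.trans (≡.cong₂ (λ γ N → γ * δ N) (κ-sym (n ∸ k) (m ∸ k) k) (ℕₚ.+-comm (n ∸ k) (m ∸ k)))
        (≡.sym (term-κ k (m ∸ k) (n ∸ k) m≡k+[m∸k] n≡k+[n∸k])))
        where
        n≡k+[n∸k] : n ≡ k ℕ.+ (n ∸ k)
        n≡k+[n∸k] = ≡.sym (m+[n∸m]≡n k≤n)
        m≡k+[m∸k] : m ≡ k ℕ.+ (m ∸ k)
        m≡k+[m∸k] = ≡.sym (m+[n∸m]≡n (≤-trans k≤n n≤m))

      product : ∀ m n → δ m * δ n ≈ D.sumTo R ι (m ℕ.⊓ n) (term m n)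
      product m n with ≤-total m n
      ... | inj₁ m≤n = begin
        δ m * δ n                        ≈⟨ product-≤ m n m≤n ⟩
        sumBelow (suc m) (term m n)      ≈⟨ sumTo≈sumBelow m (term m n) ⟨
        D.sumTo R ι m (term m n)         ≡⟨ ≡.cong (λ l → D.sumTo R ι l (term m n)) (m≤n⇒m⊓n≡m m≤n) ⟨
        D.sumTo R ι (m ℕ.⊓ n) (term m n) ∎
      ... | inj₂ n≤m = begin
        δ m * δ n                        ≈⟨ *-comm _ _ ⟩
        δ n * δ m                        ≈⟨ product-≤ n m n≤m ⟩
        sumBelow (suc n) (term n m)      ≈⟨ sumBelow-cong (suc n) (λ k k<1+n → reflexive (term-sym m n k (≤-pred k<1+n) n≤m)) ⟩
        sumBelow (suc n) (term m n)      ≈⟨ sumTo≈sumBelow n (term m n) ⟨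
        D.sumTo R ι n (term m n)         ≡⟨ ≡.cong (λ l → D.sumTo R ι l (term m n)) (m≥n⇒m⊓n≡n n≤m) ⟨
        D.sumTo R ι (m ℕ.⊓ n) (term m n) ∎

open import Defs
open import Data.Nat using (_+_; _*_; _⊓_)

theorem2p7 : ∀ {c ℓ : Level} (R : CommutativeRing c ℓ) (ι : ℚ → CommutativeRing.Carrier R)
    → IsRingHomomorphism +-*-rawRing (CommutativeRing.rawRing R) ι
    → ∀ (r x : CommutativeRing.Carrier R) (m n : ℕ)
    → CommutativeRing._≈_ R
        (CommutativeRing._*_ R (d R ι m r x) (d R ι n r x))
        (sumTo R ι (m ⊓ n) (λ k →
          CommutativeRing._*_ R
            (CommutativeRing._*_ R
              (CommutativeRing._*_ R
                (natR R ι ((m + n ∸ 2 * k) C (m ∸ k)))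
                (binom R ι (CommutativeRing._+_ R (CommutativeRing._+_ R r r) (natR R ι (m + n ∸ k))) k))
              (powR R ι (CommutativeRing.-_ R (CommutativeRing.1# R)) k))
            (d R ι (m + n ∸ 2 * k) r x)))
theorem2p7 R ι ι-hom r x m n = ProductFormula.product R ι ι-hom r x m n
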